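{- If $|\mathcal{O}|=1$, then $\mathrm{CTL}^*\mathrm{K}_m\equiv\mathrm{CTL}^*\mathrm{K}\Delta_m$ in expressive power, i.e. each of the two logics is at least as expressive as the other.
   Context: Agents $Ag=\{a_1,\dots,a_m\}$, finite set $\mathcal{O}$ of observations. $\mathrm{CTL}^*\mathrm{K}\Delta_m$ formulas are history formulas $\varphi::=p\mid\neg\varphi\mid\varphi\wedge\varphi\mid A\psi\mid K_a\varphi\mid\Delta^{o}_a\varphi$ with path formulas $\psi::=\varphi\mid\neg\psi\mid\psi\wedge\psi\mid X\psi\mid\psi U\psi$; $\mathrm{CTL}^*\mathrm{K}_m$ is the fragment without the operators $\Delta^o_a$. Both are interpreted on multiagent Kripke structures with observations $M=(AP_f,S,T,V,\{\sim_o\}_{o\in\mathcal{O}},s_{\mathrm{init}},\vec o_{\mathrm{init}})$ (left-total $T$, equivalence relations $\sim_o$, an initial observation per agent) with the dynamic synchronous perfect-recall semantics: records $\vec r$ of observation changes $(o,n)$ per agent; agent $a$'s observations at time $n$ are $\mathrm{ol}_a(\vec r,n)$ (its previous observation followed by the changes made at time $n$, starting from $(\vec o_{\mathrm{init}})_a$); $h\sim^a_{\vec r}h'$ iff $|h|=|h'|$ and $h_i\sim_oh'_i$ for all $i<|h|$, $o\in\mathrm{ol}_a(\vec r,i)$; $K_a\varphi$ holds at $h,\vec r$ iff $\varphi$ holds at all $h'\sim^a_{\vec r}h$; $\Delta^o_a\varphi$ holds at $h,\vec r$ iff $\varphi$ holds at $h,\vec r\cdot(o,|h|-1)_a$; $A,X,U$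 as in $\mathrm{CTL}^*$; $M\models\varphi$ iff $\varphi$ holds at history $s_{\mathrm{init}}$ with empty records. $\varphi\equiv\varphi'$ iff for every model $M$, $M\models\varphi\Leftrightarrow M\models\varphi'$. $L\preceq L'$ iff every formula of $L$ is equivalent to some formula of $L'$; $L\equiv L'$ iff $L\preceq L'$ and $L'\preceq L$. -}

module Defs where

open import Data.Nat using (ℕ; zero; suc; _≤_; _<_)
open import Data.Fin using (Fin; toℕ; inject₁; fromℕ) renaming (_≟_ to _≟ᶠ_)
open import Data.Fin.Properties using (toℕ-inject₁)
open import Data.List using (List; []; _∷_; _++_; [_]; map; filter)
open import Data.List.Membership.Propositional using (_∈_)
open import Data.Product using (Σ; _×_; _,_; proj₁; proj₂; ∃)
open import Relation.Nullary using (¬_; yes; no)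
open import Relation.Binary using (IsEquivalence)
open import Relation.Binary.PropositionalEquality using (_≡_; refl; subst; sym)
open import Function.Bundles using (_⇔_)
import Data.Nat as N
import Data.Fin
open import Data.Unit using (⊤)

module Syntax (AP : Set) (m : ℕ) (O : Set) where

  mutual
    data HForm : Set where
      atom : AP → HForm
      ¬ₕ_  : HForm → HForm
      _∧ₕ_ : HForm → HForm → HForm
      A    : PForm → HForm
      K    : Fin m → HForm → HForm
      Δ    : O → Fin m → HForm → HForm   -- Δ o a φ  is  Δ^o_a φ

    data PForm : Set where
      hist : HForm → PForm
      ¬ₚ_  : PForm → PForm
      _∧ₚ_ : PForm → PForm → PForm
      X    : PForm → PForm
      _U_  : PForm → PForm → PForm

  mutual
    data ΔFreeH : HForm → Set where
      atom : ∀ p → ΔFreeH (atom p)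
      ¬ₕ_  : ∀ {φ} → ΔFreeH φ → ΔFreeH (¬ₕ φ)
      _∧ₕ_ : ∀ {φ φ'} → ΔFreeH φ → ΔFreeH φ' → ΔFreeH (φ ∧ₕ φ')
      A    : ∀ {ψ} → ΔFreeP ψ → ΔFreeH (A ψ)
      K    : ∀ a {φ} → ΔFreeH φ → ΔFreeH (K a φ)

    data ΔFreeP : PForm → Set where
      hist : ∀ {φ} → ΔFreeH φ → ΔFreeP (hist φ)
      ¬ₚ_  : ∀ {ψ} → ΔFreeP ψ → ΔFreeP (¬ₚ ψ)
      _∧ₚ_ : ∀ {ψ ψ'} → ΔFreeP ψ → ΔFreeP ψ' → ΔFreeP (ψ ∧ₚ ψ')
      X    : ∀ {ψ} → ΔFreeP ψ → ΔFreeP (X ψ)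
      _U_  : ∀ {ψ ψ'} → ΔFreeP ψ → ΔFreeP ψ' → ΔFreeP (ψ U ψ')

  Logic : Set₁
  Logic = HForm → Set

  CTL*KΔ : Logic
  CTL*KΔ _ = ⊤

  CTL*K : Logic
  CTL*K = ΔFreeH

record Model (AP : Set) (m : ℕ) (O : Set) : Set₁ where
  field
    S      : Set
    T      : S → S → Set
    total  : ∀ s → ∃ λ s' → T s s'
    V      : S → AP → Set
    obsRel : O → S → S → Set
    obsEq  : ∀ o → IsEquivalence (obsRel o)
    sinit  : S
    oinit  : Fin m → O

module Semantics {AP : Set} {m : ℕ} {k : ℕ} (M : Model AP m (Fin k)) where
  open Model M
  open Syntax AP m (Fin k)

  O : Set
  O = Fin k

  -- histories of length n+1: s_init = h_0 T h_1 T ... T h_n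
  record History (n : ℕ) : Set where
    field
      st    : Fin (suc n) → S
      init  : st Data.Fin.zero ≡ sinit
      trans : (i : Fin n) → T (st (inject₁ i)) (st (Data.Fin.suc i))
  open History public

  record Path : Set where
    field
      π      : ℕ → S
      πinit  : π 0 ≡ sinit
      πtrans : ∀ i → T (π i) (π (suc i))
  open Path public

  prefix : Path → (n : ℕ) → History n
  prefix p n = record
    { st = λ i → π p (toℕ i)
    ; init = πinit p
    ; trans = λ i → subst (λ j → T (π p j) (π p (suc (toℕ i))))
                          (sym (toℕ-inject₁ i)) (πtrans p (toℕ i)) }

  Extends : ∀ {n} → Path → History n → Set
  Extends p h = ∀ i → π p (toℕ i) ≡ st h i

  -- records of observation changes, one list per agent, in order
  Rec : Set
  Rec = Fin m → List (O × ℕ)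

  emptyRec : Rec
  emptyRec _ = []

  update : Rec → Fin m → O → ℕ → Rec
  update r a o n b with b ≟ᶠ a
  ... | yes _ = r b ++ [ (o , n) ]
  ... | no  _ = r b

  changes : Rec → Fin m → ℕ → List O
  changes r a n = map proj₁ (filter (λ p → proj₂ p N.≟ n) (r a))

  lastOf : O → List O → O
  lastOf o []       = o
  lastOf _ (x ∷ xs) = lastOf x xs

  -- observation of agent a before the changes at time n
  prevObs : Rec → Fin m → ℕ → O
  prevObs r a zero    = oinit a
  prevObs r a (suc n) = lastOf (prevObs r a n) (changes r a n)

  ol : Rec → Fin m → ℕ → List O
  ol r a n = prevObs r a n ∷ changes r a n

  -- h ∼^a_r h'  (same length is enforced by the common index n)
  Indist : ∀ {n} → Rec → Fin m → History n → History n → Set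
  Indist {n} r a h h' =
    ∀ (i : Fin (suc n)) (o : O) → o ∈ ol r a (toℕ i) → obsRel o (st h i) (st h' i)

  mutual
    sat : ∀ {n} → Rec → History n → HForm → Set
    sat r h (atom p)  = V (st h (fromℕ _)) p
    sat r h (¬ₕ φ)    = ¬ sat r h φ
    sat r h (φ ∧ₕ φ') = sat r h φ × sat r h φ'
    sat {n} r h (A ψ) = ∀ (p : Path) → Extends p h → psat r p n ψ
    sat {n} r h (K a φ) = ∀ (h' : History n) → Indist r a h h' → sat r h' φ
    sat {n} r h (Δ o a φ) = sat (update r a o n) h φ

    psat : Rec → Path → ℕ → PForm → Set
    psat r p j (hist φ)  = sat r (prefix p j) φ
    psat r p j (¬ₚ ψ)    = ¬ psat r p j ψ
    psat r p j (ψ ∧ₚ ψ') = psat r p j ψ × psat r p j ψ'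
    psat r p j (X ψ)     = psat r p (suc j) ψ
    psat r p j (ψ U ψ')  =
      Σ ℕ λ l → j ≤ l × psat r p l ψ' × (∀ i → j ≤ i → i < l → psat r p i ψ)

  initHist : History 0
  initHist = record { st = λ _ → sinit ; init = refl ; trans = λ () }

  _⊨_ : HForm → Set
  _⊨_ φ = sat emptyRec initHist φ


module Expressiveness (AP : Set) (m k : ℕ) where
  open Syntax AP m (Fin k)

  _≣_ : HForm → HForm → Set₁
  φ ≣ φ' = ∀ (M : Model AP m (Fin k)) →
             (Semantics._⊨_ M φ) ⇔ (Semantics._⊨_ M φ')

  _⪯_ : Logic → Logic → Set₁
  L ⪯ L' = ∀ φ → L φ → Σ HForm λ φ' → L' φ' × (φ ≣ φ')

  _≋_ : Logic → Logic → Set₁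
  L ≋ L' = (L ⪯ L') × (L' ⪯ L)

SameExpressivePower : (AP : Set) (m k : ℕ) → Set₁
SameExpressivePower AP m k = Expressiveness._≋_ AP m k (Syntax.CTL*K AP m (Fin k)) (Syntax.CTL*KΔ AP m (Fin k))

module Submission where

-- With a single observation o₀, every observation list
-- ol_a(r,n) consists of copies of o₀, so h ∼^a_r h' holds exactly when
-- h and h' are pointwise ∼_{o₀}-related: indistinguishability does not
-- depend on the record r.  Since Δ^o_a only modifies the record, it has
-- no semantic effect, and erasing every Δ from a formula preserves its
-- truth value at every history under every record.

open import Defs
open import Data.Nat using (ℕ; suc)
open import Data.Fin using (Fin; zero; toℕ)
open import Data.Product using (_,_)
open import Data.Product.Function.NonDependent.Propositional using (_×-⇔_)
open import Data.Product.Function.Dependent.Propositional using (Σ-⇔)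
open import Data.Unit using (tt)
open import Data.List.Relation.Unary.Any using (here)
open import Relation.Binary.PropositionalEquality using (_≡_; refl; sym; subst)
open import Function.Bundles using (_⇔_; mk⇔; Equivalence)
open import Function.Related.TypeIsomorphisms using (→-cong-⇔; ¬-cong-⇔)
open import Function.Construct.Identity using (⇔-id; ↠-id)
open import Function.Construct.Symmetry using (⇔-sym)
open import Function.Construct.Composition using (_⇔-∘_)

open Equivalence using (to; from)

Π-cong-⇔ : {A : Set} {P Q : A → Set} →
           (∀ x → P x ⇔ Q x) → ((x : A) → P x) ⇔ ((x : A) → Q x)
Π-cong-⇔ P⇔Q = mk⇔ (λ f x → to (P⇔Q x) (f x)) (λ g x → from (P⇔Q x) (g x))

module Erasure (AP : Set) (m : ℕ) (O : Set) where
  open Syntax AP m O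

  mutual
    eraseΔ : HForm → HForm
    eraseΔ (atom p)    = atom p
    eraseΔ (¬ₕ φ)      = ¬ₕ eraseΔ φ
    eraseΔ (φ ∧ₕ φ')   = eraseΔ φ ∧ₕ eraseΔ φ'
    eraseΔ (A ψ)       = A (eraseΔₚ ψ)
    eraseΔ (K a φ)     = K a (eraseΔ φ)
    eraseΔ (Δ o a φ)   = eraseΔ φ

    eraseΔₚ : PForm → PForm
    eraseΔₚ (hist φ)   = hist (eraseΔ φ)
    eraseΔₚ (¬ₚ ψ)     = ¬ₚ eraseΔₚ ψ
    eraseΔₚ (ψ ∧ₚ ψ')  = eraseΔₚ ψ ∧ₚ eraseΔₚ ψ'
    eraseΔₚ (X ψ)      = X (eraseΔₚ ψ)
    eraseΔₚ (ψ U ψ')   = eraseΔₚ ψ U eraseΔₚ ψ'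

  mutual
    eraseΔ-ΔFree : ∀ φ → ΔFreeH (eraseΔ φ)
    eraseΔ-ΔFree (atom p)    = atom p
    eraseΔ-ΔFree (¬ₕ φ)      = ¬ₕ eraseΔ-ΔFree φ
    eraseΔ-ΔFree (φ ∧ₕ φ')   = eraseΔ-ΔFree φ ∧ₕ eraseΔ-ΔFree φ'
    eraseΔ-ΔFree (A ψ)       = A (eraseΔₚ-ΔFree ψ)
    eraseΔ-ΔFree (K a φ)     = K a (eraseΔ-ΔFree φ)
    eraseΔ-ΔFree (Δ o a φ)   = eraseΔ-ΔFree φ

    eraseΔₚ-ΔFree : ∀ ψ → ΔFreeP (eraseΔₚ ψ)
    eraseΔₚ-ΔFree (hist φ)   = hist (eraseΔ-ΔFree φ)
    eraseΔₚ-ΔFree (¬ₚ ψ)     = ¬ₚ eraseΔₚ-ΔFree ψ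
    eraseΔₚ-ΔFree (ψ ∧ₚ ψ')  = eraseΔₚ-ΔFree ψ ∧ₚ eraseΔₚ-ΔFree ψ'
    eraseΔₚ-ΔFree (X ψ)      = X (eraseΔₚ-ΔFree ψ)
    eraseΔₚ-ΔFree (ψ U ψ')   = eraseΔₚ-ΔFree ψ U eraseΔₚ-ΔFree ψ'

the-only-observation : (o : Fin 1) → o ≡ zero
the-only-observation zero = refl

module SingleObservation {AP : Set} {m : ℕ} (M : Model AP m (Fin 1)) where
  open Model M
  open Semantics M
  open Syntax AP m (Fin 1)
  open Erasure AP m (Fin 1)

  ObsEquivalent : ∀ {n} → History n → History n → Set
  ObsEquivalent h h' = ∀ i → obsRel zero (st h i) (st h' i)

  -- h ∼^a_r h' coincides with ObsEquivalent h h', whatever r and a are: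
  -- the unique observation is always the first entry of ol_a(r,i).
  indist⇔obsEquivalent : ∀ {n} (r : Rec) a (h h' : History n) →
                         Indist r a h h' ⇔ ObsEquivalent h h'
  indist⇔obsEquivalent r a h h' = mk⇔
    (λ indist i → indist i zero (here (sym (the-only-observation (prevObs r a (toℕ i))))))
    (λ obsEq i o _ → subst (λ o' → obsRel o' (st h i) (st h' i))
                           (sym (the-only-observation o)) (obsEq i))

  indist-record-independent : ∀ {n} (r r' : Rec) a (h h' : History n) →
                              Indist r a h h' ⇔ Indist r' a h h'
  indist-record-independent r r' a h h' =
    ⇔-sym (indist⇔obsEquivalent r' a h h') ⇔-∘ indist⇔obsEquivalent r a h h'

  -- The Δ clause changes only
  -- the record, which the induction hypothesis allows to be arbitrary.
  mutual
    sat-eraseΔ : ∀ {n} (r r' : Rec) (h : History n) φ →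
                 sat r h φ ⇔ sat r' h (eraseΔ φ)
    sat-eraseΔ r r' h (atom p)      = ⇔-id _
    sat-eraseΔ r r' h (¬ₕ φ)        = ¬-cong-⇔ (sat-eraseΔ r r' h φ)
    sat-eraseΔ r r' h (φ ∧ₕ φ')     = sat-eraseΔ r r' h φ ×-⇔ sat-eraseΔ r r' h φ'
    sat-eraseΔ {n} r r' h (A ψ)     =
      Π-cong-⇔ λ π → →-cong-⇔ (⇔-id _) (psat-eraseΔₚ r r' π n ψ)
    sat-eraseΔ r r' h (K a φ)       =
      Π-cong-⇔ λ h' → →-cong-⇔ (indist-record-independent r r' a h h')
                                (sat-eraseΔ r r' h' φ)
    sat-eraseΔ {n} r r' h (Δ o a φ) = sat-eraseΔ (update r a o n) r' h φ

    psat-eraseΔₚ : ∀ (r r' : Rec) (π : Path) (j : ℕ) ψ →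
                   psat r π j ψ ⇔ psat r' π j (eraseΔₚ ψ)
    psat-eraseΔₚ r r' π j (hist φ)  = sat-eraseΔ r r' (prefix π j) φ
    psat-eraseΔₚ r r' π j (¬ₚ ψ)    = ¬-cong-⇔ (psat-eraseΔₚ r r' π j ψ)
    psat-eraseΔₚ r r' π j (ψ ∧ₚ ψ') =
      psat-eraseΔₚ r r' π j ψ ×-⇔ psat-eraseΔₚ r r' π j ψ'
    psat-eraseΔₚ r r' π j (X ψ)     = psat-eraseΔₚ r r' π (suc j) ψ
    psat-eraseΔₚ r r' π j (ψ U ψ')  =
      Σ-⇔ (↠-id ℕ) λ {l} → ⇔-id _ ×-⇔ psat-eraseΔₚ r r' π l ψ'
        ×-⇔ Π-cong-⇔ λ i → Π-cong-⇔ λ _ → Π-cong-⇔ λ _ → psat-eraseΔₚ r r' π i ψ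

  ⊨-eraseΔ : ∀ φ → _⊨_ φ ⇔ _⊨_ (eraseΔ φ)
  ⊨-eraseΔ = sat-eraseΔ emptyRec emptyRec initHist

proposition29 : (AP : Set) (m : ℕ) → SameExpressivePower AP m 1
proposition29 AP m = CTL*K⪯CTL*KΔ , CTL*KΔ⪯CTL*K
  where
    open Syntax AP m (Fin 1)
    open Expressiveness AP m 1
    open Erasure AP m (Fin 1)

    CTL*K⪯CTL*KΔ : CTL*K ⪯ CTL*KΔ
    CTL*K⪯CTL*KΔ φ _ = φ , tt , λ _ → ⇔-id _

    CTL*KΔ⪯CTL*K : CTL*KΔ ⪯ CTL*K
    CTL*KΔ⪯CTL*K φ _ =
      eraseΔ φ , eraseΔ-ΔFree φ , λ M → SingleObservation.⊨-eraseΔ M φ
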